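{- Let $n$ be odd and let $f$ be a semilinear $n$-ary quasigroup of order $4$. Then $f$ has at least $\frac{1}{3}\left(16^{n-1}+2\cdot 8^{n-1}\right)$ transversals.
   Context: Let $\Sigma_4=\{0,1,2,3\}$. An $n$-ary quasigroup of order $4$ is a map $f:\Sigma_4^n\to\Sigma_4$ such that the equation $x_0=f(x_1,\dots,x_n)$ has a unique solution in any one of the variables $x_0,\dots,x_n$ when the other $n$ are fixed arbitrarily. A transversal in $f$ is a set of $4$ vectors $\alpha^i=(a^i_0,\dots,a^i_n)\in\Sigma_4^{n+1}$ with $a^i_0=f(a^i_1,\dots,a^i_n)$ for all $i$ and $a^i_k\ne a^j_k$ for all $i\ne j$ and all $k$. Quasigroups $f,g$ are isotopic if there are permutations $\sigma_0,\dots,\sigma_n$ of $\Sigma_4$ with $f(x_1,\dots,x_n)=\sigma_0^{ -1}(g(\sigma_1(x_1),\dots,\sigma_n(x_n)))$. Let $l(0)=l(1)=0$, $l(2)=l(3)=1$. An $n$-ary quasigroup $f$ of order $4$ is standardly semilinear if there is a Boolean function $\lambda:\mathbb{Z}_2^n\to\mathbb{Z}_2$ such that $x_0=f(x_1,\dots,x_n)$ iff $l(x_0)+\dots+l(x_n)\equiv 0\pmod 2$ and $x_0+\dots+x_n+\lambda(l(x_1),\dots,l(x_n))\equiv 0\pmod 2$ (sums of integers). A quasigroup is semilinear if it is isotopic to a standardly semilinear quasigroup. -}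

module Defs where

open import Data.Nat using (ℕ; zero; suc; _+_; _*_; _∸_; _^_; _≤_; _%_)
open import Data.Fin using (Fin; toℕ) renaming (zero to f0; suc to fs)
open import Data.Vec using (Vec; _∷_; []; head; tail; map; lookup; _[_]≔_; foldr)
open import Data.Product using (Σ; ∃; ∃!; _×_; _,_)
open import Data.Fin.Permutation using (Permutation′; _⟨$⟩ʳ_; _⟨$⟩ˡ_)
open import Function.Bundles using (_⇔_)
open import Relation.Binary.PropositionalEquality using (_≡_; _≢_)

Σ₄ : Set
Σ₄ = Fin 4

Op : ℕ → Set
Op n = Vec Σ₄ n → Σ₄

InGraph : ∀ {n} → Op n → Vec Σ₄ (suc n) → Set
InGraph f x = head x ≡ f (tail x)

-- n-ary quasigroup of order 4: for every coordinate i ∈ {0..n} and every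
-- assignment of the other coordinates, there is a unique value of xᵢ with
-- x₀ = f(x₁,…,xₙ).  (The value of x at position i is overwritten.)
IsQuasigroup : ∀ {n} → Op n → Set
IsQuasigroup {n} f =
  ∀ (i : Fin (suc n)) (x : Vec Σ₄ (suc n)) → ∃! _≡_ (λ a → InGraph f (x [ i ]≔ a))

-- A transversal is a set of 4 vectors of Σ₄^{n+1} lying in the graph
-- of f with pairwise distinct entries in every coordinate.  Since the 0-th
-- coordinates of the four vectors are pairwise distinct, they are exactly
-- 0,1,2,3; we represent the set canonically by listing its vectors in the order
-- of their 0-th coordinate (vector number i has 0-th coordinate i).  This gives a
-- bijection between transversals (as sets) and the elements of this type.
record Transversal {n : ℕ} (f : Op n) : Set where
  field
    vecs     : Vec (Vec Σ₄ (suc n)) 4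
    graph    : ∀ (i : Fin 4) → InGraph f (lookup vecs i)
    distinct : ∀ (i j : Fin 4) → i ≢ j → ∀ (k : Fin (suc n)) →
               lookup (lookup vecs i) k ≢ lookup (lookup vecs j) k
    ordered  : ∀ (i : Fin 4) → head (lookup vecs i) ≡ i

-- "f has at least N transversals": an injection from Fin N into the set of
-- transversals (equality of transversals = equality of their vectors).
AtLeastTransversals : ∀ {n} → ℕ → Op n → Set
AtLeastTransversals N f =
  Σ (Fin N → Transversal f) λ t →
    ∀ a b → Transversal.vecs (t a) ≡ Transversal.vecs (t b) → a ≡ b

Isotopic : ∀ {n} → Op n → Op n → Set
Isotopic {n} f g =
  Σ (Permutation′ 4) λ σ₀ → Σ (Vec (Permutation′ 4) n) λ σ →
    ∀ (x : Vec Σ₄ n) →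
      f x ≡ σ₀ ⟨$⟩ˡ g (Data.Vec.zipWith _⟨$⟩ʳ_ σ x)

l : Σ₄ → Fin 2
l f0 = f0
l (fs f0) = f0
l (fs (fs f0)) = fs f0
l (fs (fs (fs f0))) = fs f0

sumℕ : ∀ {m k} → Vec (Fin k) m → ℕ
sumℕ = foldr _ (λ a s → toℕ a + s) 0

Even : ℕ → Set
Even m = m % 2 ≡ 0

StandardlySemilinear : ∀ {n} → Op n → Set
StandardlySemilinear {n} f =
  Σ (Vec (Fin 2) n → Fin 2) λ lam →
    ∀ (x : Vec Σ₄ (suc n)) →
      InGraph f x ⇔
        (Even (sumℕ (map l x)) × Even (sumℕ x + toℕ (lam (map l (tail x)))))

Semilinear : ∀ {n} → Op n → Set
Semilinear {n} f =
  Σ (Op n) λ g → IsQuasigroup g × StandardlySemilinear g × Isotopic f g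

-- Identify Σ₄ with 𝔽₂² by x ↦ (l x, x mod 2).  A row (x₀, …, xₙ) lies in the graph of a standardly
-- semilinear g iff its high bits sum to 0 and its low bits sum to Λ(high bits of x₁ … xₙ), where Λ is
-- λ read over 𝔽₂.  Isotopies carry transversals injectively, so it suffices to count transversals of g,
-- i.e. rows y(0), …, y(3) ∈ Σ₄ⁿ with y(j) in the graph over j and j ↦ y(j)ₖ injective for every k.
-- Take even c, c' ∈ 𝔽₂ⁿ with Λ c + Λ ¬c = Λ c' + Λ ¬c' and high rows c, c', ¬c, ¬c' or c, c', ¬c', ¬c:
-- as n is odd their sums are right, and Λ is affine on them.  The low rows are B, B + S, B + R,
-- B + S + R, where each coordinate of (S, R) is one of the two values keeping that coordinate
-- injective, chosen by a free vector F.  The graph conditions become one nonzero linear equation on B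
-- and one on F (whose parity selects between the two high patterns), each with 2^(n-1) solutions.
-- If t resp. f even vectors c have Λ c + Λ ¬c = 1 resp. 0, this gives (t² + f²)·4^(n-1) transversals;
-- as t + f = 2^(n-1) is 1 or at least 4, 3 (t² + f²)·4^(n-1) ≥ 16^(n-1) + 2·8^(n-1).

module Submission where

open import Defs
open import Algebra.Bundles using (CommutativeRing)
open import Data.Bool using (Bool; true; false; not; _∧_; _xor_; if_then_else_) renaming (_≟_ to _≟ᵇ_)
open import Data.Bool.Properties
  using (not-involutive; not-injective; not-distribˡ-xor; xor-assoc; xor-same; xor-identityʳ;
         ∧-comm; ∧-zeroʳ; ∧-identityʳ; xor-∧-commutativeRing)
open import Algebra.Properties.CommutativeSemigroup
  (CommutativeRing.+-commutativeSemigroup xor-∧-commutativeRing) using (interchange; x∙yz≈y∙xz)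
open import Data.Empty using (⊥-elim)
import Data.List as List
open import Data.Fin using (Fin; toℕ) renaming (zero to 0F; suc to sucF; _≟_ to _≟ᶠ_)
open import Data.Fin.Permutation using (Permutation′; _⟨$⟩ʳ_; _⟨$⟩ˡ_; inverseˡ; inverseʳ)
open import Data.Fin.Properties using (all?)
open import Data.Nat using (ℕ; zero; suc; _+_; _*_; _^_; _≤_; _%_; _∸_)
open import Data.Product using (Σ; _×_; _,_; proj₁; proj₂; map₁)
open import Data.Product.Properties using (,-injectiveʳ) renaming (≡-dec to ×-≡-dec)
open import Data.Sum using (_⊎_; inj₁; inj₂)
open import Data.Vec using (Vec; []; _∷_; map; zipWith; lookup; tabulate; head; tail; replicate)
open import Data.Vec.Properties
  using (map-∘; map-cong; lookup-map; lookup-zipWith; lookup∘tabulate; zipWith-comm;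
         ∷-injectiveʳ) renaming (≡-dec to Vec-≡-dec)
open import Function using (_∘_)
open import Function.Bundles using (Equivalence; _⇔_)
open import Relation.Binary.PropositionalEquality hiding ([_])
open import Relation.Nullary.Decidable using (Dec; yes; no; from-yes; _→-dec_)

pattern 1F = sucF 0F
pattern 2F = sucF (sucF 0F)
pattern 3F = sucF (sucF (sucF 0F))

-- Parity and sums over 𝔽₂

parity : ℕ → Bool
parity zero    = false
parity (suc m) = not (parity m)

parity-+ : ∀ m n → parity (m + n) ≡ parity m xor parity n
parity-+ zero    n = refl
parity-+ (suc m) n = trans (cong not (parity-+ m n)) (not-distribˡ-xor (parity m) (parity n))

parity≡false⇒Even : ∀ m → parity m ≡ false → Even m
parity≡false⇒Even zero          _  = refl
parity≡false⇒Even (suc (suc m)) eq = parity≡false⇒Even m (trans (sym (not-involutive _)) eq)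

%2≡1⇒parity≡true : ∀ m → m % 2 ≡ 1 → parity m ≡ true
%2≡1⇒parity≡true (suc zero)    _  = refl
%2≡1⇒parity≡true (suc (suc m)) eq = trans (not-involutive _) (%2≡1⇒parity≡true m eq)

xor-cancelˡ : ∀ x y → x xor (x xor y) ≡ y
xor-cancelˡ x y = trans (sym (xor-assoc x x y)) (cong (_xor y) (xor-same x))

xor-cancelʳ : ∀ x y → (x xor y) xor y ≡ x
xor-cancelʳ x y = trans (xor-assoc x y y) (trans (cong (x xor_) (xor-same y)) (xor-identityʳ x))

⊕-sum : ∀ {n} → Vec Bool n → Bool
⊕-sum []       = false
⊕-sum (x ∷ xs) = x xor ⊕-sum xs

parity-sumℕ : ∀ {m k} (v : Vec (Fin k) m) → parity (sumℕ v) ≡ ⊕-sum (map (parity ∘ toℕ) v)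
parity-sumℕ []      = refl
parity-sumℕ (x ∷ v) = trans (parity-+ (toℕ x) (sumℕ v)) (cong (parity (toℕ x) xor_) (parity-sumℕ v))

⊕-sum-xor : ∀ {n} (u v : Vec Bool n) → ⊕-sum (zipWith _xor_ u v) ≡ ⊕-sum u xor ⊕-sum v
⊕-sum-xor []      []      = refl
⊕-sum-xor (x ∷ u) (y ∷ v) = trans (cong ((x xor y) xor_) (⊕-sum-xor u v)) (interchange x y _ _)

⊕-sum-not : ∀ {n} (v : Vec Bool n) → ⊕-sum (map not v) ≡ parity n xor ⊕-sum v
⊕-sum-not []               = refl
⊕-sum-not {suc n} (x ∷ v) = begin
  not x xor ⊕-sum (map not v)        ≡⟨ cong (not x xor_) (⊕-sum-not v) ⟩
  not x xor (parity n xor ⊕-sum v)   ≡⟨ not-distribˡ-xor x _ ⟨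
  not (x xor (parity n xor ⊕-sum v)) ≡⟨ cong not (x∙yz≈y∙xz x (parity n) (⊕-sum v)) ⟩
  not (parity n xor (x xor ⊕-sum v)) ≡⟨ not-distribˡ-xor (parity n) _ ⟩
  not (parity n) xor (x xor ⊕-sum v) ∎
  where open ≡-Reasoning

infix 8 _·_
_·_ : ∀ {n} → Vec Bool n → Vec Bool n → Bool
u · v = ⊕-sum (zipWith _∧_ u v)

·-comm : ∀ {n} (u v : Vec Bool n) → u · v ≡ v · u
·-comm u v = cong ⊕-sum (zipWith-comm ∧-comm u v)

·-not : ∀ {n} (u v : Vec Bool n) → u · map not v ≡ ⊕-sum u xor u · v
·-not []      []      = refl
·-not (x ∷ u) (y ∷ v) = trans (cong (x ∧ not y xor_) (·-not u v)) (step x)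
  where
  step : ∀ x → x ∧ not y xor (⊕-sum u xor u · v) ≡ (x xor ⊕-sum u) xor (x ∧ y xor u · v)
  step false = refl
  step true  = trans (sym (not-distribˡ-xor y _))
    (trans (cong not (x∙yz≈y∙xz y (⊕-sum u) (u · v))) (not-distribˡ-xor (⊕-sum u) _))

not-· : ∀ {n} (u v : Vec Bool n) → map not u · v ≡ ⊕-sum v xor u · v
not-· u v = trans (·-comm (map not u) v) (trans (·-not v u) (cong (⊕-sum v xor_) (·-comm v u)))

replicate-true-· : ∀ {n} (v : Vec Bool n) → replicate n true · v ≡ ⊕-sum v
replicate-true-· []      = refl
replicate-true-· (x ∷ v) = cong (x xor_) (replicate-true-· v)

zipWith-xor-cancelˡ : ∀ {n} {u v v' : Vec Bool n} → zipWith _xor_ u v ≡ zipWith _xor_ u v' → v ≡ v'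
zipWith-xor-cancelˡ {u = []}    {[]}    {[]}      _  = refl
zipWith-xor-cancelˡ {u = x ∷ u} {y ∷ v} {y' ∷ v'} eq = cong₂ _∷_
  (trans (sym (xor-cancelˡ x y)) (trans (cong ((x xor_) ∘ head) eq) (xor-cancelˡ x y')))
  (zipWith-xor-cancelˡ (cong tail eq))

map-not-injective : ∀ {n} {u v : Vec Bool n} → map not u ≡ map not v → u ≡ v
map-not-injective {u = []}    {[]}    _  = refl
map-not-injective {u = x ∷ u} {y ∷ v} eq =
  cong₂ _∷_ (not-injective (cong head eq)) (map-not-injective (cong tail eq))

zipWith-xor-self : ∀ {n} (u : Vec Bool n) → zipWith _xor_ u u ≡ replicate n false
zipWith-xor-self []      = refl
zipWith-xor-self (x ∷ u) = cong₂ _∷_ (xor-same x) (zipWith-xor-self u)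

replicate-false-· : ∀ {n} (v : Vec Bool n) → replicate n false · v ≡ false
replicate-false-· []      = refl
replicate-false-· (x ∷ v) = replicate-false-· v

-- Σ₄ as 𝔽₂²

high low : Σ₄ → Bool
high = parity ∘ toℕ ∘ l
low  = parity ∘ toℕ

fromBits : Bool → Bool → Σ₄
fromBits false false = 0F
fromBits false true  = 1F
fromBits true  false = 2F
fromBits true  true  = 3F

high-fromBits : ∀ u v → high (fromBits u v) ≡ u
high-fromBits false false = refl
high-fromBits false true  = refl
high-fromBits true  false = refl
high-fromBits true  true  = refl

low-fromBits : ∀ u v → low (fromBits u v) ≡ v
low-fromBits false false = refl
low-fromBits false true  = refl
low-fromBits true  false = refl
low-fromBits true  true  = refl

fromBits-injective : ∀ {u v u' v'} → fromBits u v ≡ fromBits u' v' → u ≡ u' × v ≡ v'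
fromBits-injective {u} {v} {u'} {v'} eq =
  trans (sym (high-fromBits u v)) (trans (cong high eq) (high-fromBits u' v')) ,
  trans (sym (low-fromBits u v)) (trans (cong low eq) (low-fromBits u' v'))

map-high-zipWith : ∀ {n} (u v : Vec Bool n) → map high (zipWith fromBits u v) ≡ u
map-high-zipWith []      []      = refl
map-high-zipWith (x ∷ u) (y ∷ v) = cong₂ _∷_ (high-fromBits x y) (map-high-zipWith u v)

map-low-zipWith : ∀ {n} (u v : Vec Bool n) → map low (zipWith fromBits u v) ≡ v
map-low-zipWith []      []      = refl
map-low-zipWith (x ∷ u) (y ∷ v) = cong₂ _∷_ (low-fromBits x y) (map-low-zipWith u v)

zipWith-fromBits-injective : ∀ {n} {u v u' v' : Vec Bool n} →
  zipWith fromBits u v ≡ zipWith fromBits u' v' → u ≡ u' × v ≡ v'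
zipWith-fromBits-injective {u = u} {v} {u'} {v'} eq =
  trans (sym (map-high-zipWith u v)) (trans (cong (map high) eq) (map-high-zipWith u' v')) ,
  trans (sym (map-low-zipWith u v)) (trans (cong (map low) eq) (map-low-zipWith u' v'))

bit : Bool → Fin 2
bit false = 0F
bit true  = 1F

bit-high : ∀ x → bit (high x) ≡ l x
bit-high 0F = refl
bit-high 1F = refl
bit-high 2F = refl
bit-high 3F = refl

-- Enumerating solutions of linear equations over 𝔽₂

module Enumeration where

  open import Data.List as List using (List; []; _∷_; [_]; _++_; concatMap; filter; length)
  open import Data.List.Membership.Propositional using (_∈_)
  open import Data.List.Membership.Propositional.Properties using (∈-++⁻; ∈-map⁻; ∈-lookup)
  open import Data.List.Properties using (length-++; length-map)
  open import Data.List.Relation.Unary.All as All using ()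
  open import Data.List.Relation.Unary.Any using (here; there)
  open import Data.List.Relation.Unary.AllPairs using ([]; _∷_)
  open import Data.List.Relation.Unary.Unique.Propositional using (Unique)
  open import Data.List.Relation.Unary.Unique.Propositional.Properties using (map⁺; ++⁺)
  open import Data.List.Relation.Binary.Disjoint.Propositional using (Disjoint)
  open import Data.Nat.ListAction using (sum)
  open import Data.Nat.Properties using (+-suc; +-identityʳ)

  module _ {A : Set} where

    lookup-injective : ∀ {xs : List A} → Unique xs → ∀ {i j} → List.lookup xs i ≡ List.lookup xs j → i ≡ j
    lookup-injective (_  ∷ _) {0F}     {0F}     _  = refl
    lookup-injective (x∉ ∷ _) {0F}     {sucF j} eq = ⊥-elim (All.lookup x∉ (∈-lookup j) eq)
    lookup-injective (x∉ ∷ _) {sucF i} {0F}     eq = ⊥-elim (All.lookup x∉ (∈-lookup i) (sym eq))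
    lookup-injective (_  ∷ u) {sucF i} {sucF j} eq = cong sucF (lookup-injective u eq)

    length-filter-true+false : ∀ (h : A → Bool) xs →
      length (filter (λ x → h x ≟ᵇ true) xs) + length (filter (λ x → h x ≟ᵇ false) xs) ≡ length xs
    length-filter-true+false h []       = refl
    length-filter-true+false h (x ∷ xs) with h x
    ... | true  = cong suc (length-filter-true+false h xs)
    ... | false = trans (+-suc _ _) (cong suc (length-filter-true+false h xs))

  module _ {A B : Set} where

    infixr 5 _⊗_
    _⊗_ : List A → (A → List B) → List (A × B)
    xs ⊗ g = concatMap (λ x → List.map (x ,_) (g x)) xs

    ∈-⊗⁻ : ∀ xs g {x y} → (x , y) ∈ xs ⊗ g → x ∈ xs × y ∈ g x
    ∈-⊗⁻ (x' ∷ xs) g p with ∈-++⁻ (List.map (x' ,_) (g x')) p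
    ... | inj₁ p' with ∈-map⁻ (x' ,_) p'
    ...   | _ , y∈ , refl = here refl , y∈
    ∈-⊗⁻ (x' ∷ xs) g p | inj₂ p' = map₁ there (∈-⊗⁻ xs g p')

    ⊗-unique : ∀ {xs g} → Unique xs → (∀ x → Unique (g x)) → Unique (xs ⊗ g)
    ⊗-unique {[]}     []         _  = []
    ⊗-unique {x ∷ xs} {g} (x∉ ∷ u) ug = ++⁺ (map⁺ ,-injectiveʳ (ug x)) (⊗-unique u ug) disjoint
      where
      disjoint : Disjoint (List.map (x ,_) (g x)) (xs ⊗ g)
      disjoint (p , q) with ∈-map⁻ (x ,_) p
      ... | _ , _ , refl = All.lookup x∉ (proj₁ (∈-⊗⁻ xs g q)) refl

    length-⊗ : ∀ xs {g} → length (xs ⊗ g) ≡ sum (List.map (length ∘ g) xs)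
    length-⊗ []           = refl
    length-⊗ (x ∷ xs) {g} =
      trans (length-++ (List.map (x ,_) (g x))) (cong₂ _+_ (length-map _ (g x)) (length-⊗ xs))

    length-⊗-const : ∀ {m} xs {g} → (∀ x → length (g x) ≡ m) → length (xs ⊗ g) ≡ length xs * m
    length-⊗-const []       _         = refl
    length-⊗-const (x ∷ xs) {g} len = trans (length-++ (List.map (x ,_) (g x)))
      (cong₂ _+_ (trans (length-map _ (g x)) (len x)) (length-⊗-const xs len))

  solutions : ∀ {m} → Vec Bool m → Bool → List (Vec Bool m)
  solutions []      false = [ [] ]
  solutions []      true  = []
  solutions (q ∷ Q) y     = List.map (false ∷_) (solutions Q y) ++ List.map (true ∷_) (solutions Q (q xor y))

  ∈-solutions⁻ : ∀ {m} (Q : Vec Bool m) {y F} → F ∈ solutions Q y → Q · F ≡ y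
  ∈-solutions⁻ [] {false} (here refl) = refl
  ∈-solutions⁻ (q ∷ Q) {y} p with ∈-++⁻ (List.map (false ∷_) (solutions Q y)) p
  ... | inj₁ p' with ∈-map⁻ (false ∷_) p'
  ...   | F , F∈ , refl = trans (cong (_xor Q · F) (∧-zeroʳ q)) (∈-solutions⁻ Q F∈)
  ∈-solutions⁻ (q ∷ Q) {y} p | inj₂ p' with ∈-map⁻ (true ∷_) p'
  ...   | F , F∈ , refl = trans (cong₂ _xor_ (∧-identityʳ q) (∈-solutions⁻ Q F∈)) (xor-cancelˡ q y)

  solutions-unique : ∀ {m} (Q : Vec Bool m) y → Unique (solutions Q y)
  solutions-unique []      false = All.[] ∷ []
  solutions-unique []      true  = []
  solutions-unique (q ∷ Q) y     =
    ++⁺ (map⁺ ∷-injectiveʳ (solutions-unique Q y)) (map⁺ ∷-injectiveʳ (solutions-unique Q (q xor y)))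
        disjoint
    where
    disjoint : Disjoint (List.map (false ∷_) (solutions Q y)) (List.map (true ∷_) (solutions Q (q xor y)))
    disjoint (p , p') with ∈-map⁻ (false ∷_) p | ∈-map⁻ (true ∷_) p'
    ... | _ , _ , refl | _ , _ , ()

  length-halves : ∀ {m} (A B : List (Vec Bool m)) →
    length (List.map (false ∷_) A ++ List.map (true ∷_) B) ≡ length A + length B
  length-halves A B = trans (length-++ (List.map _ A)) (cong₂ _+_ (length-map _ A) (length-map _ B))

  length-solutions-zero : ∀ m y → length (solutions (replicate m false) y) ≡ (if y then 0 else 2 ^ m)
  length-solutions-zero zero    false = refl
  length-solutions-zero zero    true  = refl
  length-solutions-zero (suc m) y     =
    trans (length-halves (solutions (replicate m false) y) _)
          (trans (cong₂ _+_ (length-solutions-zero m y) (length-solutions-zero m y)) (double y))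
    where
    double : ∀ y → (if y then 0 else 2 ^ m) + (if y then 0 else 2 ^ m) ≡ (if y then 0 else 2 ^ suc m)
    double true  = refl
    double false = cong (2 ^ m +_) (sym (+-identityʳ (2 ^ m)))

  length-solutions : ∀ {k} (Q : Vec Bool (suc k)) → Q ≢ replicate (suc k) false → ∀ y →
    length (solutions Q y) ≡ 2 ^ k
  length-solutions {k} (q ∷ Q) Q≢0 y with Vec-≡-dec _≟ᵇ_ Q (replicate k false)
  length-solutions (false ∷ Q) Q≢0 y | yes refl = ⊥-elim (Q≢0 refl)
  length-solutions {k} (true ∷ Q) _ y | yes refl =
    trans (length-halves (solutions Q y) _)
          (trans (cong₂ _+_ (length-solutions-zero k y) (length-solutions-zero k (not y))) (complementary y))
    where
    complementary : ∀ y → (if y then 0 else 2 ^ k) + (if not y then 0 else 2 ^ k) ≡ 2 ^ k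
    complementary true  = refl
    complementary false = +-identityʳ (2 ^ k)
  length-solutions {zero}  (q ∷ []) _ y | no Q≢0 = ⊥-elim (Q≢0 refl)
  length-solutions {suc k} (q ∷ Q)  _ y | no Q≢0 =
    trans (length-halves (solutions Q y) _)
          (trans (cong₂ _+_ (length-solutions Q Q≢0 y) (length-solutions Q Q≢0 (q xor y)))
                 (cong (2 ^ k +_) (sym (+-identityʳ (2 ^ k)))))

-- Transversals described by their rows

record RowTransversal {n} (g : Op n) : Set where
  field
    row      : Σ₄ → Vec Σ₄ n
    in-graph : ∀ j → g (row j) ≡ j
    distinct : ∀ k {i j} → lookup (row i) k ≡ lookup (row j) k → i ≡ j

module _ {n} {g : Op n} where
  open RowTransversal

  labelled : RowTransversal g → Σ₄ → Vec Σ₄ (suc n)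
  labelled T j = j ∷ row T j

  toTransversal : RowTransversal g → Transversal g
  toTransversal T = record
    { vecs     = tabulate (labelled T)
    ; graph    = λ j → subst (InGraph g) (sym (lookup∘tabulate (labelled T) j)) (sym (in-graph T j))
    ; distinct = λ i j i≢j k → subst₂ (λ u v → lookup u k ≢ lookup v k)
                   (sym (lookup∘tabulate (labelled T) i)) (sym (lookup∘tabulate (labelled T) j))
                   (separated i≢j k)
    ; ordered  = λ j → cong head (lookup∘tabulate (labelled T) j)
    }
    where
    separated : ∀ {i j} → i ≢ j → ∀ k → lookup (labelled T i) k ≢ lookup (labelled T j) k
    separated i≢j 0F       = i≢j
    separated i≢j (sucF k) = i≢j ∘ distinct T k

  toTransversal-injective : ∀ T T' →
    Transversal.vecs (toTransversal T) ≡ Transversal.vecs (toTransversal T') → ∀ j → row T j ≡ row T' j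
  toTransversal-injective T T' eq j = cong tail (begin
    labelled T j                        ≡⟨ lookup∘tabulate (labelled T) j ⟨
    lookup (tabulate (labelled T)) j    ≡⟨ cong (λ vs → lookup vs j) eq ⟩
    lookup (tabulate (labelled T')) j   ≡⟨ lookup∘tabulate (labelled T') j ⟩
    labelled T' j                       ∎)
    where open ≡-Reasoning

⟨$⟩ʳ-injective : ∀ {m} (π : Permutation′ m) {x y} → π ⟨$⟩ʳ x ≡ π ⟨$⟩ʳ y → x ≡ y
⟨$⟩ʳ-injective π eq = trans (sym (inverseˡ π)) (trans (cong (π ⟨$⟩ˡ_) eq) (inverseˡ π))

⟨$⟩ˡ-injective : ∀ {m} (π : Permutation′ m) {x y} → π ⟨$⟩ˡ x ≡ π ⟨$⟩ˡ y → x ≡ y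
⟨$⟩ˡ-injective π eq = trans (sym (inverseʳ π)) (trans (cong (π ⟨$⟩ʳ_) eq) (inverseʳ π))

permute unpermute : ∀ {n} → Vec (Permutation′ 4) n → Vec Σ₄ n → Vec Σ₄ n
permute   = zipWith _⟨$⟩ʳ_
unpermute = zipWith _⟨$⟩ˡ_

permute-unpermute : ∀ {n} (σ : Vec (Permutation′ 4) n) y → permute σ (unpermute σ y) ≡ y
permute-unpermute []      []       = refl
permute-unpermute (π ∷ σ) (y ∷ ys) = cong₂ _∷_ (inverseʳ π) (permute-unpermute σ ys)

unpermute-injective : ∀ {n} (σ : Vec (Permutation′ 4) n) {y y'} → unpermute σ y ≡ unpermute σ y' → y ≡ y'
unpermute-injective σ {y} {y'} eq =
  trans (sym (permute-unpermute σ y)) (trans (cong (permute σ) eq) (permute-unpermute σ y'))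

module _ {n} {f g : Op n} where
  open RowTransversal

  isotope : Isotopic f g → RowTransversal g → RowTransversal f
  isotope (σ₀ , σ , f≡) T = record
    { row      = λ i → unpermute σ (row T (σ₀ ⟨$⟩ʳ i))
    ; in-graph = λ i → begin
        f (unpermute σ (row T (σ₀ ⟨$⟩ʳ i)))
          ≡⟨ f≡ _ ⟩
        σ₀ ⟨$⟩ˡ g (permute σ (unpermute σ (row T (σ₀ ⟨$⟩ʳ i))))
          ≡⟨ cong (λ y → σ₀ ⟨$⟩ˡ g y) (permute-unpermute σ _) ⟩
        σ₀ ⟨$⟩ˡ g (row T (σ₀ ⟨$⟩ʳ i))
          ≡⟨ cong (σ₀ ⟨$⟩ˡ_) (in-graph T _) ⟩
        σ₀ ⟨$⟩ˡ (σ₀ ⟨$⟩ʳ i)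
          ≡⟨ inverseˡ σ₀ ⟩
        i ∎
    ; distinct = λ k {i} {j} eq → ⟨$⟩ʳ-injective σ₀ (distinct T k (⟨$⟩ˡ-injective (lookup σ k)
        (trans (sym (lookup-zipWith _⟨$⟩ˡ_ k σ (row T (σ₀ ⟨$⟩ʳ i))))
          (trans eq (lookup-zipWith _⟨$⟩ˡ_ k σ (row T (σ₀ ⟨$⟩ʳ j)))))))
    }
    where open ≡-Reasoning

  isotope-injective : ∀ iso T T' → (∀ i → row (isotope iso T) i ≡ row (isotope iso T') i) →
    ∀ j → row T j ≡ row T' j
  isotope-injective (σ₀ , σ , _) T T' eq j =
    subst (λ j → row T j ≡ row T' j) (inverseʳ σ₀) (unpermute-injective σ (eq (σ₀ ⟨$⟩ˡ j)))

-- The graph of a standardly semilinear quasigroup in terms of bits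

module StandardlySemilinear {n} (g : Op n) (lam : Vec (Fin 2) n → Fin 2)
  (graph : ∀ x → InGraph g x ⇔ (Even (sumℕ (map l x)) × Even (sumℕ x + toℕ (lam (map l (tail x)))))) where

  Λ : Vec Bool n → Bool
  Λ v = parity (toℕ (lam (map bit v)))

  inGraph-fromBits : ∀ x → ⊕-sum (map high x) ≡ false →
    ⊕-sum (map low x) xor Λ (map high (tail x)) ≡ false → InGraph g x
  inGraph-fromBits x high-sum low-sum = Equivalence.from (graph x) (even-l , even-low)
    where
    open ≡-Reasoning
    bits-l : map bit (map high (tail x)) ≡ map l (tail x)
    bits-l = trans (sym (map-∘ bit high (tail x))) (map-cong bit-high (tail x))
    even-l : Even (sumℕ (map l x))
    even-l = parity≡false⇒Even (sumℕ (map l x)) (trans (parity-sumℕ (map l x))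
               (trans (sym (cong ⊕-sum (map-∘ (parity ∘ toℕ) l x))) high-sum))
    even-low : Even (sumℕ x + toℕ (lam (map l (tail x))))
    even-low = parity≡false⇒Even (sumℕ x + toℕ (lam (map l (tail x)))) (begin
      parity (sumℕ x + toℕ (lam (map l (tail x))))
        ≡⟨ parity-+ (sumℕ x) _ ⟩
      parity (sumℕ x) xor parity (toℕ (lam (map l (tail x))))
        ≡⟨ cong₂ _xor_ (parity-sumℕ x) (cong (λ v → parity (toℕ (lam v))) (sym bits-l)) ⟩
      ⊕-sum (map low x) xor Λ (map high (tail x))
        ≡⟨ low-sum ⟩
      false ∎)

  bitRows-transversal : (H L : Σ₄ → Vec Bool n) →
    (∀ j → ⊕-sum (H j) ≡ high j) → (∀ j → ⊕-sum (L j) xor Λ (H j) ≡ low j) →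
    (∀ k {i j} → lookup (H i) k ≡ lookup (H j) k → lookup (L i) k ≡ lookup (L j) k → i ≡ j) →
    RowTransversal g
  bitRows-transversal H L high-sums low-sums cells-distinct = record
    { row      = row
    ; in-graph = λ j → sym (inGraph-fromBits (j ∷ row j) (high-sum j) (low-sum j))
    ; distinct = λ k {i} {j} eq →
        let high≡ , low≡ = fromBits-injective (trans (sym (lookup-row i k)) (trans eq (lookup-row j k)))
        in cells-distinct k high≡ low≡
    }
    where
    open ≡-Reasoning
    row : Σ₄ → Vec Σ₄ n
    row j = zipWith fromBits (H j) (L j)
    lookup-row : ∀ j k → lookup (row j) k ≡ fromBits (lookup (H j) k) (lookup (L j) k)
    lookup-row j k = lookup-zipWith fromBits k (H j) (L j)
    high-sum : ∀ j → ⊕-sum (map high (j ∷ row j)) ≡ false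
    high-sum j = begin
      high j xor ⊕-sum (map high (row j)) ≡⟨ cong (λ v → high j xor ⊕-sum v) (map-high-zipWith (H j) (L j)) ⟩
      high j xor ⊕-sum (H j)               ≡⟨ cong (high j xor_) (high-sums j) ⟩
      high j xor high j                    ≡⟨ xor-same (high j) ⟩
      false                                ∎
    low-sum : ∀ j → ⊕-sum (map low (j ∷ row j)) xor Λ (map high (row j)) ≡ false
    low-sum j = begin
      (low j xor ⊕-sum (map low (row j))) xor Λ (map high (row j))
        ≡⟨ cong₂ (λ u v → (low j xor ⊕-sum u) xor Λ v)
                 (map-low-zipWith (H j) (L j)) (map-high-zipWith (H j) (L j)) ⟩
      (low j xor ⊕-sum (L j)) xor Λ (H j)  ≡⟨ xor-assoc (low j) _ _ ⟩
      low j xor (⊕-sum (L j) xor Λ (H j))  ≡⟨ cong (low j xor_) (low-sums j) ⟩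
      low j xor low j                      ≡⟨ xor-same (low j) ⟩
      false                                ∎

-- The k-th coordinates of the four rows, given the k-th entries a, a', f, b of c, c', F, B;
-- s and r are the low-bit differences of rows 1 and 2 from row 0.

s r : Bool → Bool → Bool → Bool
s false q f = not (q ∧ f)
s true  q f = not (q ∧ not f)
r false q f = f
r true  q f = not (not q ∧ f)

cellHigh : Bool → Bool → Bool → Σ₄ → Bool
cellHigh e     a a' 0F = a
cellHigh e     a a' 1F = a'
cellHigh false a a' 2F = not a
cellHigh true  a a' 2F = not a'
cellHigh false a a' 3F = not a'
cellHigh true  a a' 3F = not a

cellLow : Bool → Bool → Bool → Bool → Σ₄ → Bool
cellLow e q f b 0F = b
cellLow e q f b 1F = b xor s e q f
cellLow e q f b 2F = b xor r e q f
cellLow e q f b 3F = b xor (s e q f xor r e q f)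

cell : (e a a' f b : Bool) → Σ₄ → Bool × Bool
cell e a a' f b j = cellHigh e a a' j , cellLow e (a xor a') f b j

∀-Bool? : ∀ {P : Bool → Set} → (∀ b → Dec (P b)) → Dec (∀ b → P b)
∀-Bool? P? with P? false | P? true
... | yes p | yes q = yes λ { false → p ; true → q }
... | no ¬p | _     = no λ h → ¬p (h false)
... | yes _ | no ¬q = no λ h → ¬q (h true)

-- Each cell is an affine bijection of 𝔽₂²; checked on all 32 parameter values.
cell-injective : ∀ e a a' f b i j → cell e a a' f b i ≡ cell e a a' f b j → i ≡ j
cell-injective = from-yes (∀-Bool? λ e → ∀-Bool? λ a → ∀-Bool? λ a' → ∀-Bool? λ f → ∀-Bool? λ b →
  all? λ i → all? λ j → ×-≡-dec _≟ᵇ_ _≟ᵇ_ (cell e a a' f b i) (cell e a a' f b j) →-dec i ≟ᶠ j)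

s-r-injective : ∀ e q {f f'} → s e q f ≡ s e q f' → r e q f ≡ r e q f' → f ≡ f'
s-r-injective false q     _  r≡ = r≡
s-r-injective true  false _  r≡ = not-injective r≡
s-r-injective true  true  s≡ _  = trans (sym (not-involutive _)) (trans s≡ (not-involutive _))

highRow : ∀ {n} → Bool → (c c' : Vec Bool n) → Σ₄ → Vec Bool n
highRow e     c c' 0F = c
highRow e     c c' 1F = c'
highRow false c c' 2F = map not c
highRow true  c c' 2F = map not c'
highRow false c c' 3F = map not c'
highRow true  c c' 3F = map not c

S R : ∀ {n} → Bool → (Q F : Vec Bool n) → Vec Bool n
S false Q F = map not (zipWith _∧_ Q F)
S true  Q F = map not (zipWith _∧_ Q (map not F))
R false Q F = F
R true  Q F = map not (zipWith _∧_ (map not Q) F)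

lowRow : ∀ {n} → Bool → (Q F B : Vec Bool n) → Σ₄ → Vec Bool n
lowRow e Q F B 0F = B
lowRow e Q F B 1F = zipWith _xor_ B (S e Q F)
lowRow e Q F B 2F = zipWith _xor_ B (R e Q F)
lowRow e Q F B 3F = zipWith _xor_ B (zipWith _xor_ (S e Q F) (R e Q F))

lookup-highRow : ∀ {n} e (c c' : Vec Bool n) j k →
  lookup (highRow e c c' j) k ≡ cellHigh e (lookup c k) (lookup c' k) j
lookup-highRow e     c c' 0F k = refl
lookup-highRow e     c c' 1F k = refl
lookup-highRow false c c' 2F k = lookup-map k not c
lookup-highRow true  c c' 2F k = lookup-map k not c'
lookup-highRow false c c' 3F k = lookup-map k not c'
lookup-highRow true  c c' 3F k = lookup-map k not c

lookup-S : ∀ {n} e (Q F : Vec Bool n) k → lookup (S e Q F) k ≡ s e (lookup Q k) (lookup F k)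
lookup-S false Q F k = trans (lookup-map k not (zipWith _∧_ Q F)) (cong not (lookup-zipWith _∧_ k Q F))
lookup-S true  Q F k = trans (lookup-map k not (zipWith _∧_ Q (map not F)))
  (cong not (trans (lookup-zipWith _∧_ k Q (map not F)) (cong (lookup Q k ∧_) (lookup-map k not F))))

lookup-R : ∀ {n} e (Q F : Vec Bool n) k → lookup (R e Q F) k ≡ r e (lookup Q k) (lookup F k)
lookup-R false Q F k = refl
lookup-R true  Q F k = trans (lookup-map k not (zipWith _∧_ (map not Q) F))
  (cong not (trans (lookup-zipWith _∧_ k (map not Q) F) (cong (_∧ lookup F k) (lookup-map k not Q))))

lookup-lowRow : ∀ {n} e (Q F B : Vec Bool n) j k →
  lookup (lowRow e Q F B j) k ≡ cellLow e (lookup Q k) (lookup F k) (lookup B k) j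
lookup-lowRow e Q F B 0F k = refl
lookup-lowRow e Q F B 1F k = trans (lookup-zipWith _xor_ k B _) (cong (lookup B k xor_) (lookup-S e Q F k))
lookup-lowRow e Q F B 2F k = trans (lookup-zipWith _xor_ k B _) (cong (lookup B k xor_) (lookup-R e Q F k))
lookup-lowRow e Q F B 3F k = trans (lookup-zipWith _xor_ k B _) (cong (lookup B k xor_)
  (trans (lookup-zipWith _xor_ k (S e Q F) _) (cong₂ _xor_ (lookup-S e Q F k) (lookup-R e Q F k))))

S-R-injective : ∀ {n} e (Q F G : Vec Bool n) → S e Q F ≡ S e Q G → R e Q F ≡ R e Q G → F ≡ G
S-R-injective false Q       F       G       _  R≡ = R≡
S-R-injective true  []      []      []      _  _  = refl
S-R-injective true  (q ∷ Q) (f ∷ F) (g ∷ G) S≡ R≡ = cong₂ _∷_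
  (s-r-injective true q (cong head S≡) (cong head R≡)) (S-R-injective true Q F G (cong tail S≡) (cong tail R≡))

-- The low-bit conditions of rows 1 and 3, and the sum of R true, once Λ is affine on the high rows.
row₁-identity : ∀ x y → (x xor not (x xor y)) xor y ≡ true
row₁-identity false false = refl
row₁-identity false true  = refl
row₁-identity true  false = refl
row₁-identity true  true  = refl

row₃-identity : ∀ x y z → (x xor (not (x xor y) xor (x xor z))) xor (x xor (y xor z)) ≡ true
row₃-identity false false false = refl
row₃-identity false false true  = refl
row₃-identity false true  false = refl
row₃-identity false true  true  = refl
row₃-identity true  false false = refl
row₃-identity true  false true  = refl
row₃-identity true  true  false = refl
row₃-identity true  true  true  = refl

R-identity : ∀ x y z → not (not (x xor (x xor (y xor z))) xor (x xor y)) ≡ x xor z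
R-identity false false false = refl
R-identity false false true  = refl
R-identity false true  false = refl
R-identity false true  true  = refl
R-identity true  false false = refl
R-identity true  false true  = refl
R-identity true  true  false = refl
R-identity true  true  true  = refl

-- The counting inequality

module Counting where

  open import Data.Nat.Properties
    using (≤-refl; m≤m+n; *-monoʳ-≤; *-monoˡ-≤; *-cancelˡ-≤; +-monoʳ-≤; +-comm; *-comm; *-assoc; ≤-total;
           m≤n⇒∃[o]m+o≡n; m^n>0; ^-*-assoc; module ≤-Reasoning)
  open import Data.Nat.Tactic.RingSolver using (solve-∀)

  2^k≡1⊎4≤2^k : ∀ k → parity (suc k) ≡ true → 2 ^ k ≡ 1 ⊎ 4 ≤ 2 ^ k
  2^k≡1⊎4≤2^k zero          _ = inj₁ refl
  2^k≡1⊎4≤2^k (suc (suc k)) _ = inj₂ (*-monoʳ-≤ 2 (*-monoʳ-≤ 2 (m^n>0 2 k)))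

  square-of-sum≤-ordered : ∀ {t f} → t ≤ f → (t + f) * (t + f) ≤ 2 * (t * t + f * f)
  square-of-sum≤-ordered {t} t≤f with m≤n⇒∃[o]m+o≡n t≤f
  ... | d , refl = subst ((t + (t + d)) * (t + (t + d)) ≤_) (sym (identity t d)) (m≤m+n _ (d * d))
    where
    identity : ∀ t d → 2 * (t * t + (t + d) * (t + d)) ≡ (t + (t + d)) * (t + (t + d)) + d * d
    identity = solve-∀

  square-of-sum≤ : ∀ t f → (t + f) * (t + f) ≤ 2 * (t * t + f * f)
  square-of-sum≤ t f with ≤-total t f
  ... | inj₁ t≤f = square-of-sum≤-ordered t≤f
  ... | inj₂ f≤t = subst₂ _≤_ (cong (λ x → x * x) (+-comm f t)) (cong (2 *_) (+-comm (f * f) (t * t)))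
                     (square-of-sum≤-ordered f≤t)

  sum-of-squares-bound : ∀ t f → t + f ≡ 1 ⊎ 4 ≤ t + f →
    (t + f) * (t + f) + 2 * (t + f) ≤ 3 * (t * t + f * f)
  sum-of-squares-bound t f (inj₁ t+f≡1) = one t f t+f≡1
    where
    one : ∀ t f → t + f ≡ 1 → (t + f) * (t + f) + 2 * (t + f) ≤ 3 * (t * t + f * f)
    one zero       (suc zero) _ = ≤-refl
    one (suc zero) zero       _ = ≤-refl
  sum-of-squares-bound t f (inj₂ 4≤K) = *-cancelˡ-≤ 2 (begin
    2 * (K * K + 2 * K)       ≡⟨ double K ⟩
    2 * (K * K) + K * 4       ≤⟨ +-monoʳ-≤ (2 * (K * K)) (*-monoʳ-≤ K 4≤K) ⟩
    2 * (K * K) + K * K       ≡⟨ triple K ⟩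
    3 * (K * K)               ≤⟨ *-monoʳ-≤ 3 (square-of-sum≤ t f) ⟩
    3 * (2 * (t * t + f * f)) ≡⟨ swap (t * t + f * f) ⟩
    2 * (3 * (t * t + f * f)) ∎)
    where
    open ≤-Reasoning
    K : ℕ
    K = t + f
    double : ∀ K → 2 * (K * K + 2 * K) ≡ 2 * (K * K) + K * 4
    double = solve-∀
    triple : ∀ K → 2 * (K * K) + K * K ≡ 3 * (K * K)
    triple = solve-∀
    swap : ∀ A → 3 * (2 * A) ≡ 2 * (3 * A)
    swap = solve-∀

  pow-swap : ∀ m k → (2 ^ m) ^ k ≡ (2 ^ k) ^ m
  pow-swap m k = trans (^-*-assoc 2 m k) (trans (cong (2 ^_) (*-comm m k)) (sym (^-*-assoc 2 k m)))

  count-bound : ∀ k t f → parity (suc k) ≡ true → t + f ≡ 2 ^ k →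
    16 ^ k + 2 * 8 ^ k ≤ 3 * ((t * t + f * f) * (2 ^ k * 2 ^ k))
  count-bound k t f n-odd t+f≡K = begin
    16 ^ k + 2 * 8 ^ k                      ≡⟨ cong₂ (λ a b → a + 2 * b) (pow-swap 4 k) (pow-swap 3 k) ⟩
    K ^ 4 + 2 * K ^ 3                       ≡⟨ powers K ⟩
    (K * K + 2 * K) * (K * K)               ≤⟨ *-monoˡ-≤ (K * K) bound ⟩
    3 * (t * t + f * f) * (K * K)           ≡⟨ *-assoc 3 (t * t + f * f) (K * K) ⟩
    3 * ((t * t + f * f) * (K * K))         ∎
    where
    open ≤-Reasoning
    K : ℕ
    K = 2 ^ k
    powers : ∀ K → K * (K * (K * (K * 1))) + 2 * (K * (K * (K * 1))) ≡ (K * K + 2 * K) * (K * K)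
    powers = solve-∀
    bound : K * K + 2 * K ≤ 3 * (t * t + f * f)
    bound = subst (λ K → K * K + 2 * K ≤ 3 * (t * t + f * f)) t+f≡K
      (sum-of-squares-bound t f (subst (λ K → K ≡ 1 ⊎ 4 ≤ K) (sym t+f≡K) (2^k≡1⊎4≤2^k k n-odd)))

-- A family of transversals of a standardly semilinear quasigroup of odd arity

module Family {k} (g : Op (suc k)) (lam : Vec (Fin 2) (suc k) → Fin 2)
  (graph : ∀ x → InGraph g x ⇔ (Even (sumℕ (map l x)) × Even (sumℕ x + toℕ (lam (map l (tail x))))))
  (n-odd : parity (suc k) ≡ true) where

  open StandardlySemilinear g lam graph
  open Enumeration
  open import Data.List as List using (List; []; _∷_; filter; length)
  open import Data.List.Membership.Propositional using (_∈_)
  open import Data.List.Membership.Propositional.Properties using (∈-filter⁻; ∈-lookup)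
  open import Data.List.Relation.Unary.All as All using ()
  open import Data.List.Relation.Unary.AllPairs using ([]; _∷_)
  open import Data.List.Relation.Unary.Unique.Propositional using (Unique)
  open import Data.List.Relation.Unary.Unique.Propositional.Properties using (filter⁺)
  open import Data.Nat.Tactic.RingSolver using (solve-∀)

  private
    V : Set
    V = Vec Bool (suc k)

  Λ-flip : V → Bool
  Λ-flip c = Λ c xor Λ (map not c)

  -- c and c' are the high bits of rows 0 and 1, B the low bits of row 0, and F the free parameters.
  record Admissible (c c' F B : V) : Set where
    field
      c-even    : ⊕-sum c ≡ false
      c'-even   : ⊕-sum c' ≡ false
      same-flip : Λ-flip c ≡ Λ-flip c'
      dot       : zipWith _xor_ c c' · F ≡ Λ c xor Λ c'
      low-sum   : ⊕-sum B ≡ Λ c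
      diagonal  : c ≡ c' → ⊕-sum F ≡ Λ-flip c

  -- Chooses which of ¬c, ¬c' is the high row 2; reading it off ⊕-sum F is what lets one linear
  -- equation on F cover both choices.
  twist : V → V → Bool
  twist c F = ⊕-sum F xor Λ-flip c

  ⊕-sum-not-even : ∀ (v : V) → ⊕-sum v ≡ false → ⊕-sum (map not v) ≡ true
  ⊕-sum-not-even v v-even = trans (⊕-sum-not v) (cong₂ _xor_ n-odd v-even)

  high-sums : ∀ e {c c' : V} → ⊕-sum c ≡ false → ⊕-sum c' ≡ false →
    ∀ j → ⊕-sum (highRow e c c' j) ≡ high j
  high-sums e             c-even c'-even 0F = c-even
  high-sums e             c-even c'-even 1F = c'-even
  high-sums false {c}     c-even c'-even 2F = ⊕-sum-not-even c c-even
  high-sums true  {c' = c'} c-even c'-even 2F = ⊕-sum-not-even c' c'-even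
  high-sums false {c' = c'} c-even c'-even 3F = ⊕-sum-not-even c' c'-even
  high-sums true  {c}     c-even c'-even 3F = ⊕-sum-not-even c c-even

  module _ {c c' F B : V} (adm : Admissible c c' F B) where
    open Admissible adm

    private
      Q : V
      Q = zipWith _xor_ c c'
      Λ₂ : Bool → Bool
      Λ₂ e = Λ (highRow e c c' 2F)

    Λ-affine : ∀ e → Λ (highRow e c c' 3F) ≡ Λ c xor (Λ c' xor Λ₂ e)
    Λ-affine false = trans (sym (xor-cancelˡ (Λ c') _))
      (trans (cong (Λ c' xor_) (sym same-flip)) (x∙yz≈y∙xz (Λ c') (Λ c) _))
    Λ-affine true  = trans (sym (xor-cancelˡ (Λ c) _)) (cong (Λ c xor_) same-flip)

    sum-S : ∀ e → ⊕-sum (S e Q F) ≡ not (Λ c xor Λ c')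
    sum-S false = trans (⊕-sum-not (zipWith _∧_ Q F)) (cong₂ _xor_ n-odd dot)
    sum-S true  = trans (⊕-sum-not (zipWith _∧_ Q (map not F)))
      (cong₂ _xor_ n-odd (trans (·-not Q F) (cong₂ _xor_ Q-even dot)))
      where
      Q-even : ⊕-sum Q ≡ false
      Q-even = trans (⊕-sum-xor c c') (cong₂ _xor_ c-even c'-even)

    sum-R : ∀ e → ⊕-sum F ≡ e xor Λ-flip c → ⊕-sum (R e Q F) ≡ Λ c xor Λ₂ e
    sum-R false F-sum = F-sum
    sum-R true  F-sum = begin
      ⊕-sum (map not (zipWith _∧_ (map not Q) F))         ≡⟨ ⊕-sum-not (zipWith _∧_ (map not Q) F) ⟩
      parity (suc k) xor map not Q · F                   ≡⟨ cong₂ _xor_ n-odd (not-· Q F) ⟩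
      not (⊕-sum F xor Q · F)                            ≡⟨ cong₂ (λ u v → not (u xor v)) F-sum dot ⟩
      not (not (Λ c xor Λ (map not c)) xor (Λ c xor Λ c'))
        ≡⟨ cong (λ u → not (not (Λ c xor u) xor (Λ c xor Λ c'))) (Λ-affine true) ⟩
      not (not (Λ c xor (Λ c xor (Λ c' xor Λ₂ true))) xor (Λ c xor Λ c'))
        ≡⟨ R-identity (Λ c) (Λ c') (Λ₂ true) ⟩
      Λ c xor Λ₂ true                                    ∎
      where open ≡-Reasoning

    low-sums : ∀ e → ⊕-sum F ≡ e xor Λ-flip c → ∀ j →
      ⊕-sum (lowRow e Q F B j) xor Λ (highRow e c c' j) ≡ low j
    low-sums e F-sum 0F = trans (cong (_xor Λ c) low-sum) (xor-same (Λ c))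
    low-sums e F-sum 1F = trans
      (cong (_xor Λ c') (trans (⊕-sum-xor B (S e Q F)) (cong₂ _xor_ low-sum (sum-S e))))
      (row₁-identity (Λ c) (Λ c'))
    low-sums e F-sum 2F = trans
      (cong (_xor Λ₂ e) (trans (⊕-sum-xor B (R e Q F)) (cong₂ _xor_ low-sum (sum-R e F-sum))))
      (trans (cong (_xor Λ₂ e) (xor-cancelˡ (Λ c) (Λ₂ e))) (xor-same (Λ₂ e)))
    low-sums e F-sum 3F = trans
      (cong₂ _xor_ (trans (⊕-sum-xor B _) (cong₂ _xor_ low-sum
          (trans (⊕-sum-xor (S e Q F) (R e Q F)) (cong₂ _xor_ (sum-S e) (sum-R e F-sum)))))
        (Λ-affine e))
      (row₃-identity (Λ c) (Λ c') (Λ₂ e))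

    familyTransversal : RowTransversal g
    familyTransversal = bitRows-transversal (highRow e c c') (lowRow e Q F B)
      (high-sums e c-even c'-even) (low-sums e F-sum) cells-distinct
      where
      e : Bool
      e = twist c F
      F-sum : ⊕-sum F ≡ e xor Λ-flip c
      F-sum = sym (xor-cancelʳ (⊕-sum F) (Λ-flip c))
      cells-distinct : ∀ k {i j} → lookup (highRow e c c' i) k ≡ lookup (highRow e c c' j) k →
        lookup (lowRow e Q F B i) k ≡ lookup (lowRow e Q F B j) k → i ≡ j
      cells-distinct k {i} {j} h≡ l≡ =
        cell-injective e (lookup c k) (lookup c' k) (lookup F k) (lookup B k) i j
          (trans (sym (lookup-cell i)) (trans (cong₂ _,_ h≡ l≡) (lookup-cell j)))
        where
        lookup-cell : ∀ j → (lookup (highRow e c c' j) k , lookup (lowRow e Q F B j) k) ≡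
                            cell e (lookup c k) (lookup c' k) (lookup F k) (lookup B k) j
        lookup-cell j = cong₂ _,_ (lookup-highRow e c c' j k)
          (trans (lookup-lowRow e Q F B j k)
                 (cong (λ q → cellLow e q (lookup F k) (lookup B k) j) (lookup-zipWith _xor_ k c c')))

  diagonal-twist : ∀ {c c' F B} → Admissible c c' F B → c ≡ c' → twist c F ≡ false
  diagonal-twist {c} adm c≡c' = trans (cong (_xor Λ-flip c) (Admissible.diagonal adm c≡c')) (xor-same (Λ-flip c))

  twist-determined : ∀ {c c' : V} e e' → highRow e c c' 2F ≡ highRow e' c c' 2F →
    (c ≡ c' → e ≡ false) → (c ≡ c' → e' ≡ false) → e ≡ e'
  twist-determined false false _  _  _  = refl
  twist-determined true  true  _  _  _  = refl
  twist-determined false true  eq _  e' = sym (e' (map-not-injective eq))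
  twist-determined true  false eq e  _  = e (sym (map-not-injective eq))

  familyTransversal-injective : ∀ {c c' F B d d' G D} (adm : Admissible c c' F B) (adm' : Admissible d d' G D) →
    (∀ j → RowTransversal.row (familyTransversal adm) j ≡ RowTransversal.row (familyTransversal adm') j) →
    (c , c' , F , B) ≡ (d , d' , G , D)
  familyTransversal-injective {c} {c'} {F} {B} {G = G} adm adm' rows≡
    with zipWith-fromBits-injective (rows≡ 0F) | zipWith-fromBits-injective (rows≡ 1F)
  ... | refl , refl | refl , low₁≡ = cong (λ G → c , c' , G , B) (S-R-injective (twist c G) Q F G
          (subst (λ e → S e Q F ≡ S (twist c G) Q G) twist≡ (zipWith-xor-cancelˡ low₁≡))
          (subst (λ e → R e Q F ≡ R (twist c G) Q G) twist≡ (zipWith-xor-cancelˡ (proj₂ row₂≡))))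
    where
    Q : V
    Q = zipWith _xor_ c c'
    row₂≡ : highRow (twist c F) c c' 2F ≡ highRow (twist c G) c c' 2F ×
            lowRow (twist c F) Q F B 2F ≡ lowRow (twist c G) Q G B 2F
    row₂≡ = zipWith-fromBits-injective (rows≡ 2F)
    twist≡ : twist c F ≡ twist c G
    twist≡ = twist-determined (twist c F) (twist c G) (proj₁ row₂≡) (diagonal-twist adm) (diagonal-twist adm')

  ones : V
  ones = replicate (suc k) true

  evens : List V
  evens = solutions ones false

  flipClass : Bool → List V
  flipClass b = filter (λ c → Λ-flip c ≟ᵇ b) evens

  freeVectors : V → V → List V
  freeVectors c c' with Vec-≡-dec _≟ᵇ_ c c'
  ... | yes _ = solutions ones (Λ-flip c)
  ... | no  _ = solutions (zipWith _xor_ c c') (Λ c xor Λ c')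

  lowVectors : V → List V
  lowVectors c = solutions ones (Λ c)

  completions : V → V → List (V × V)
  completions c c' = freeVectors c c' ⊗ λ _ → lowVectors c

  pairsFrom : Bool → V → List (V × V × V)
  pairsFrom b c = flipClass b ⊗ completions c

  parametersIn : Bool → List (V × V × V × V)
  parametersIn b = flipClass b ⊗ pairsFrom b

  parameters : List (Bool × V × V × V × V)
  parameters = (true ∷ false ∷ []) ⊗ parametersIn

  ∈-ones⁻ : ∀ {y F} → F ∈ solutions ones y → ⊕-sum F ≡ y
  ∈-ones⁻ {F = F} F∈ = trans (sym (replicate-true-· F)) (∈-solutions⁻ ones F∈)

  ∈-flipClass⁻ : ∀ {b c} → c ∈ flipClass b → ⊕-sum c ≡ false × Λ-flip c ≡ b
  ∈-flipClass⁻ {b} c∈ = map₁ ∈-ones⁻ (∈-filter⁻ (λ c → Λ-flip c ≟ᵇ b) c∈)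

  ∈-freeVectors⁻ : ∀ {c c' F} → F ∈ freeVectors c c' →
    zipWith _xor_ c c' · F ≡ Λ c xor Λ c' × (c ≡ c' → ⊕-sum F ≡ Λ-flip c)
  ∈-freeVectors⁻ {c} {c'} {F} F∈ with Vec-≡-dec _≟ᵇ_ c c'
  ... | yes refl = trans (cong (_· F) (zipWith-xor-self c)) (trans (replicate-false-· F) (sym (xor-same (Λ c)))) ,
                   λ _ → ∈-ones⁻ F∈
  ... | no c≢c'  = ∈-solutions⁻ (zipWith _xor_ c c') F∈ , λ c≡c' → ⊥-elim (c≢c' c≡c')

  parameter-admissible : ∀ {b c c' F B} → (b , c , c' , F , B) ∈ parameters →
    Admissible c c' F B × Λ-flip c ≡ b
  parameter-admissible {b} {c} {c'} p with ∈-⊗⁻ (true ∷ false ∷ []) parametersIn p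
  ... | _ , p₁ with ∈-⊗⁻ (flipClass b) (pairsFrom b) p₁
  ... | c∈ , p₂ with ∈-⊗⁻ (flipClass b) (completions c) p₂
  ... | c'∈ , p₃ with ∈-⊗⁻ (freeVectors c c') (λ _ → lowVectors c) p₃
  ... | F∈ , B∈ = record
    { c-even    = proj₁ (∈-flipClass⁻ c∈)
    ; c'-even   = proj₁ (∈-flipClass⁻ c'∈)
    ; same-flip = trans (proj₂ (∈-flipClass⁻ c∈)) (sym (proj₂ (∈-flipClass⁻ c'∈)))
    ; dot       = proj₁ (∈-freeVectors⁻ F∈)
    ; low-sum   = ∈-ones⁻ B∈
    ; diagonal  = proj₂ (∈-freeVectors⁻ F∈)
    } , proj₂ (∈-flipClass⁻ c∈)

  parameters-determined : ∀ {b c c' F B b' d d' G D}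
    (p : (b , c , c' , F , B) ∈ parameters) (p' : (b' , d , d' , G , D) ∈ parameters) →
    (∀ j → RowTransversal.row (familyTransversal (proj₁ (parameter-admissible p))) j ≡
           RowTransversal.row (familyTransversal (proj₁ (parameter-admissible p'))) j) →
    (b , c , c' , F , B) ≡ (b' , d , d' , G , D)
  parameters-determined p p' rows≡
    with familyTransversal-injective (proj₁ (parameter-admissible p)) (proj₁ (parameter-admissible p')) rows≡
  ... | refl = cong (_, _) (trans (sym (proj₂ (parameter-admissible p))) (proj₂ (parameter-admissible p')))

  ones≢zero : ones ≢ replicate (suc k) false
  ones≢zero ()

  flipClass-unique : ∀ b → Unique (flipClass b)
  flipClass-unique b = filter⁺ (λ c → Λ-flip c ≟ᵇ b) (solutions-unique ones false)

  freeVectors-unique : ∀ c c' → Unique (freeVectors c c')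
  freeVectors-unique c c' with Vec-≡-dec _≟ᵇ_ c c'
  ... | yes _ = solutions-unique ones (Λ-flip c)
  ... | no  _ = solutions-unique (zipWith _xor_ c c') (Λ c xor Λ c')

  parameters-unique : Unique parameters
  parameters-unique = ⊗-unique (((λ ()) All.∷ All.[]) ∷ All.[] ∷ []) λ b →
    ⊗-unique (flipClass-unique b) λ c → ⊗-unique (flipClass-unique b) λ c' →
    ⊗-unique (freeVectors-unique c c') λ _ → solutions-unique ones (Λ c)

  length-freeVectors : ∀ c c' → length (freeVectors c c') ≡ 2 ^ k
  length-freeVectors c c' with Vec-≡-dec _≟ᵇ_ c c'
  ... | yes _    = length-solutions ones ones≢zero (Λ-flip c)
  ... | no c≢c' = length-solutions (zipWith _xor_ c c') Q≢0 (Λ c xor Λ c')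
    where
    Q≢0 : zipWith _xor_ c c' ≢ replicate (suc k) false
    Q≢0 Q≡0 = c≢c' (sym (zipWith-xor-cancelˡ (trans Q≡0 (sym (zipWith-xor-self c)))))

  length-parametersIn : ∀ b →
    length (parametersIn b) ≡ length (flipClass b) * (length (flipClass b) * (2 ^ k * 2 ^ k))
  length-parametersIn b = length-⊗-const (flipClass b) λ c → length-⊗-const (flipClass b) λ c' →
    trans (length-⊗-const (freeVectors c c') λ _ → length-solutions ones ones≢zero (Λ c))
          (cong (_* 2 ^ k) (length-freeVectors c c'))

  flipClass-sizes : length (flipClass true) + length (flipClass false) ≡ 2 ^ k
  flipClass-sizes = trans (length-filter-true+false Λ-flip evens) (length-solutions ones ones≢zero false)

  enough-parameters : 16 ^ k + 2 * 8 ^ k ≤ 3 * length parameters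
  enough-parameters = subst (λ N → 16 ^ k + 2 * 8 ^ k ≤ 3 * N) (sym length-parameters)
    (Counting.count-bound k t f n-odd flipClass-sizes)
    where
    t f : ℕ
    t = length (flipClass true)
    f = length (flipClass false)
    regroup : ∀ t f M → t * (t * M) + (f * (f * M) + 0) ≡ (t * t + f * f) * M
    regroup = solve-∀
    length-parameters : length parameters ≡ (t * t + f * f) * (2 ^ k * 2 ^ k)
    length-parameters = trans (length-⊗ (true ∷ false ∷ []) {parametersIn})
      (trans (cong₂ (λ u v → u + (v + 0)) (length-parametersIn true) (length-parametersIn false)) (regroup t f _))

  transversals : ∀ {f} → Isotopic f g → AtLeastTransversals (length parameters) f
  transversals {f} iso = transversal , injective
    where
    rowsAt : Fin (length parameters) → RowTransversal g
    rowsAt a = familyTransversal (proj₁ (parameter-admissible (∈-lookup a)))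
    transversal : Fin (length parameters) → Transversal f
    transversal a = toTransversal (isotope iso (rowsAt a))
    injective : ∀ a b → Transversal.vecs (transversal a) ≡ Transversal.vecs (transversal b) → a ≡ b
    injective a b eq = lookup-injective parameters-unique (parameters-determined (∈-lookup a) (∈-lookup b)
      (isotope-injective iso (rowsAt a) (rowsAt b)
        (toTransversal-injective (isotope iso (rowsAt a)) (isotope iso (rowsAt b)) eq)))

corollary2 : ∀ (n : ℕ) → n % 2 ≡ 1 → (f : Op n) → IsQuasigroup f → Semilinear f →
    Σ ℕ (λ N → (16 ^ (n ∸ 1) + 2 * 8 ^ (n ∸ 1) ≤ 3 * N) × AtLeastTransversals N f)
corollary2 zero    ()
corollary2 (suc k) n-odd f _ (g , _ , (lam , graph) , iso) =
  List.length parameters , enough-parameters , transversals iso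
  where open Family g lam graph (%2≡1⇒parity≡true (suc k) n-odd)
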